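{- Let $K_1$ and $K_2$ be two cliques in $\Gamma$ whose vertex sets are vertex sets of $7$-crosspolytopes in the $E_8$ root polytope, and let $f\colon K_1\to K_2$ be an isomorphism of colored graphs. Then $f$ extends to an automorphism of $\Lambda$ if and only if for every subclique $S=\{e_1,\ldots,e_7\}$ of $K_1$ consisting of $7$ vertices pairwise joined by edges of color $1$, the vectors $\sum_{i=1}^7 e_i$ and $\sum_{i=1}^7 f(e_i)$ either both lie in $2\Lambda$ or both do not.
   Context: $\Lambda=\{a\in \mathbb{Z}^8+\langle(\tfrac12,\ldots,\tfrac12)\rangle : \sum_i a_i\in 2\mathbb{Z}\}$ is the $E_8$ lattice, $E=\{a\in\Lambda:\|a\|=\sqrt2\}$, and $\Gamma$ the complete colored graph on $E$ with edge color $e\cdot f$; a clique is a complete colored subgraph, and an isomorphism of cliques is a color-preserving bijection of vertices. $W$ is the Weyl group of $E_8$, equal to the automorphism group of $\Lambda$; "$f$ extends" means some $w\in W$ restricts to $f$ on the vertices of $K_1$. A $7$-crosspolytope in the $E_8$ root polytope (the convex hull of $E$) is given by $14$ roots $e_1,\ldots,e_7,f_1,\ldots,f_7$ with $e_i\cdot f_i=0$ for all $i$ and $e_i\cdot e_j=e_i\cdot f_j=f_i\cdot f_j=1$ for all $i\neq j$; these are facets of the polytope. -}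

module Defs where

open import Data.Nat using (ℕ; zero; suc)
open import Data.Integer using (ℤ; +_; _+_; _*_)
open import Data.Integer.Divisibility using (_∣_)
open import Data.Fin using (Fin; zero; suc)
open import Data.Vec using (Vec; zipWith; replicate)
import Data.Vec as V
open import Data.Vec.Relation.Unary.All using (All)
open import Data.Sum using (_⊎_; inj₁; inj₂)
open import Data.Product using (Σ; ∃; _×_; _,_)
open import Relation.Binary.PropositionalEquality using (_≡_; _≢_)
open import Relation.Nullary using (¬_)

-- Points of ℝ⁸ with half-integer coordinates are represented by their
-- DOUBLED coordinates: a ∈ ℝ⁸ is stored as x = 2a ∈ ℤ⁸.
V8 : Set
V8 = Vec ℤ 8

sumℤ : ∀ {n} → Vec ℤ n → ℤ
sumℤ = V.foldr _ _+_ (+ 0)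

Even : ℤ → Set
Even z = (+ 2) ∣ z

Odd : ℤ → Set
Odd z = (+ 2) ∣ (z + + 1)

-- a ∈ Λ  ⇔  a ∈ ℤ⁸ ∪ (ℤ+½)⁸ and Σ aᵢ ∈ 2ℤ
--        ⇔  x = 2a has all coordinates even or all odd, and 4 ∣ Σ xᵢ.
InΛ : V8 → Set
InΛ x = (All Even x ⊎ All Odd x) × ((+ 4) ∣ sumℤ x)

_⊕_ : V8 → V8 → V8
x ⊕ y = zipWith _+_ x y

twice : V8 → V8
twice x = V.map ((+ 2) *_) x

-- dot x y = Σ xᵢ yᵢ = 4 (a · b)   (for x = 2a, y = 2b).
dot : V8 → V8 → ℤ
dot x y = sumℤ (zipWith _*_ x y)

In2Λ : V8 → Set
In2Λ x = Σ V8 λ y → InΛ y × (x ≡ twice y)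

-- Roots: a ∈ Λ with ‖a‖² = 2, i.e. dot x x = 8.
IsRoot : V8 → Set
IsRoot x = InΛ x × (dot x x ≡ + 8)

vsum : ∀ {n} → (Fin n → V8) → V8
vsum {zero}  v = replicate 8 (+ 0)
vsum {suc n} v = v zero ⊕ vsum (λ i → v (suc i))

record AutΛ : Set where
  field
    map        : V8 → V8
    closed     : ∀ x → InΛ x → InΛ (map x)
    additive   : ∀ x y → InΛ x → InΛ y → map (x ⊕ y) ≡ map x ⊕ map y
    isometry   : ∀ x y → InΛ x → InΛ y → dot (map x) (map y) ≡ dot x y
    injective  : ∀ x y → InΛ x → InΛ y → map x ≡ map y → x ≡ y
    surjective : ∀ y → InΛ y → Σ V8 λ x → InΛ x × (map x ≡ y)

Idx : Set
Idx = Fin 7 ⊎ Fin 7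

vert : (Fin 7 → V8) → (Fin 7 → V8) → Idx → V8
vert e f (inj₁ i) = e i
vert e f (inj₂ i) = f i

record IsCrossPolytope (e f : Fin 7 → V8) : Set where
  field
    roots : ∀ k → IsRoot (vert e f k)
    ef0   : ∀ i → dot (e i) (f i) ≡ + 0
    ee1   : ∀ i j → i ≢ j → dot (e i) (e j) ≡ + 4
    ef1   : ∀ i j → i ≢ j → dot (e i) (f j) ≡ + 4
    ff1   : ∀ i j → i ≢ j → dot (f i) (f j) ≡ + 4

-- Put C = eᵢ + fᵢ (the same vector for every i) and Dᵢ = eᵢ − fᵢ.  These eight
-- vectors are pairwise orthogonal of norm 4, and eight such vectors determine
-- every vector of ℝ⁸ by its inner products with them (nine vectors of ℤ⁸ are
-- linearly dependent).  So a colour-preserving bijection of two crosspolytopes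
-- is the restriction of exactly one linear isometry, the one matching the two
-- frames, and it extends to Λ iff that isometry maps Λ onto Λ.  Expanding
-- x ∈ Λ in the frame shows 2x ≡ 0, C, Σeᵢ or f₁ + e₂ + … + e₇ modulo twice the
-- span of C, e₁, …, e₇; the class of C is impossible, as C/2 would be a lattice
-- vector of norm 1.  Hence Λ is preserved exactly when the two 7-cliques
-- e₁, …, e₇ and f₁, e₂, …, e₇ keep their membership in 2Λ; conversely, every
-- automorphism preserves 2Λ-membership of sums of lattice vectors.

module Submission where

open import Defs
open import Data.Nat as ℕ using (ℕ; zero; suc)
import Data.Nat.Properties as ℕP
import Data.Nat.Divisibility as ℕDiv
open import Data.Integer as ℤ using (ℤ; +_; +[1+_]; -[1+_]; _+_; _*_; -_; _-_)
import Data.Integer.Properties as ℤP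
import Data.Integer.DivMod as ℤD
open import Data.Integer.Divisibility.Signed as Div using (_∣_; divides; ∣ᵤ⇒∣; ∣⇒∣ᵤ)
open import Data.Integer.Tactic.RingSolver using (solve-∀)
open import Data.Fin as Fin using (Fin; zero; suc; punchIn)
import Data.Fin.Properties as FinP
open import Data.Vec as V using (Vec; []; _∷_; lookup; replicate; tabulate; zipWith)
import Data.Vec.Properties as VP
open import Data.Vec.Relation.Binary.Pointwise.Extensional using (ext; Pointwise-≡⇒≡)
open import Data.Vec.Relation.Unary.All as All using (All)
open import Data.Vec.Relation.Unary.All.Properties using (lookup⁺; lookup⁻)
open import Data.Vec.Functional using (insertAt)
open import Data.Vec.Functional.Properties using (insertAt-lookup; insertAt-punchIn)
open import Data.Product using (Σ; ∃; _×_; _,_; proj₁; proj₂)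
open import Data.Sum using (_⊎_; inj₁; inj₂; [_,_]′)
open import Data.Empty using (⊥-elim)
open import Relation.Binary.PropositionalEquality
open import Relation.Nullary using (¬_; ¬?; Dec; yes; no)
open import Function using (_∘_; _↔_; _⇔_; Inverse)
open import Function.Bundles using (mk⇔; Equivalence)

open import Algebra.Properties.Semiring.Sum ℤP.+-*-semiring
  using (sum; sum-cong-≗; sum-remove; sum-replicate-zero; ∑-distrib-+;
         *-distribˡ-sum; *-distribʳ-sum)

sum-supported : ∀ {n} (t : Fin (suc n) → ℤ) i → (∀ k → k ≢ i → t k ≡ + 0) → sum t ≡ t i
sum-supported {n} t i vanish = begin
  sum t                          ≡⟨ sum-remove t ⟩
  t i + sum (t ∘ punchIn i)      ≡⟨ cong (_+_ (t i)) (sum-cong-≗ (λ k → vanish (punchIn i k) (FinP.punchInᵢ≢i i k))) ⟩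
  t i + sum {n} (λ _ → + 0)      ≡⟨ cong (_+_ (t i)) (sum-replicate-zero n) ⟩
  t i + + 0                      ≡⟨ ℤP.+-identityʳ (t i) ⟩
  t i                            ∎
  where open ≡-Reasoning

sum-affine : ∀ {m} n a (b : Fin m → ℤ) → sum (λ i → n - a * b i) ≡ + m * n - a * sum b
sum-affine {zero}  n a b = sym (lemma n a)
  where
  lemma : ∀ n a → + 0 * n - a * + 0 ≡ + 0
  lemma = solve-∀
sum-affine {suc m} n a b = trans (cong (_+_ (n - a * b zero)) (sum-affine n a (b ∘ suc))) (lemma n a (b zero) (sum (b ∘ suc)) (+ m))
  where
  lemma : ∀ n a b₀ s m → n - a * b₀ + (m * n - a * s) ≡ (+ 1 + m) * n - a * (b₀ + s)
  lemma = solve-∀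

lookup-ext : ∀ {n} {x y : Vec ℤ n} → (∀ j → lookup x j ≡ lookup y j) → x ≡ y
lookup-ext eq = Pointwise-≡⇒≡ (ext eq)

scale : ℤ → V8 → V8
scale k = V.map (k *_)

_⊖_ : V8 → V8 → V8
x ⊖ y = x ⊕ scale (- + 1) y

0ᵥ : V8
0ᵥ = replicate 8 (+ 0)

lookup-⊕ : ∀ x y j → lookup (x ⊕ y) j ≡ lookup x j + lookup y j
lookup-⊕ x y j = VP.lookup-zipWith _+_ j x y

lookup-scale : ∀ k x j → lookup (scale k x) j ≡ k * lookup x j
lookup-scale k x j = VP.lookup-map j (k *_) x

lookup-⊖ : ∀ x y j → lookup (x ⊖ y) j ≡ lookup x j - lookup y j
lookup-⊖ x y j = trans (lookup-⊕ x (scale (- + 1) y) j)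
  (cong (_+_ (lookup x j)) (trans (lookup-scale (- + 1) y j) (ℤP.-1*i≡-i (lookup y j))))

lookup-0ᵥ : ∀ j → lookup 0ᵥ j ≡ + 0
lookup-0ᵥ j = VP.lookup-replicate j (+ 0)

lookup-vsum : ∀ {n} (v : Fin n → V8) j → lookup (vsum v) j ≡ sum (λ i → lookup (v i) j)
lookup-vsum {zero}  v j = lookup-0ᵥ j
lookup-vsum {suc n} v j = trans (lookup-⊕ (v zero) (vsum (v ∘ suc)) j) (cong (_+_ (lookup (v zero) j)) (lookup-vsum (v ∘ suc) j))

lookup-vsum-scale : ∀ {n} (a : Fin n → ℤ) (v : Fin n → V8) j →
                    lookup (vsum (λ i → scale (a i) (v i))) j ≡ sum (λ i → a i * lookup (v i) j)
lookup-vsum-scale a v j = trans (lookup-vsum (λ i → scale (a i) (v i)) j) (sum-cong-≗ λ i → lookup-scale (a i) (v i) j)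

⊖-⊕-cancel : ∀ x y → (x ⊖ y) ⊕ y ≡ x
⊖-⊕-cancel x y = lookup-ext λ j →
  trans (lookup-⊕ (x ⊖ y) y j) (trans (cong (_+ lookup y j) (lookup-⊖ x y j)) (lemma (lookup x j) (lookup y j)))
  where
  lemma : ∀ a b → a - b + b ≡ a
  lemma = solve-∀

vsum-cong : ∀ {n} {v w : Fin n → V8} → (∀ i → v i ≡ w i) → vsum v ≡ vsum w
vsum-cong {zero}  eq = refl
vsum-cong {suc n} eq = cong₂ _⊕_ (eq zero) (vsum-cong (eq ∘ suc))

twice≡⊕ : ∀ y → twice y ≡ y ⊕ y
twice≡⊕ y = lookup-ext λ j → trans (lookup-scale (+ 2) y j) (trans (lemma (lookup y j)) (sym (lookup-⊕ y y j)))
  where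
  lemma : ∀ a → + 2 * a ≡ a + a
  lemma = solve-∀

dot≡sum : ∀ {n} (x y : Vec ℤ n) → sumℤ (zipWith _*_ x y) ≡ sum (λ j → lookup x j * lookup y j)
dot≡sum []      []      = refl
dot≡sum (a ∷ x) (b ∷ y) = cong (_+_ (a * b)) (dot≡sum x y)

sumℤ≡sum : ∀ {n} (x : Vec ℤ n) → sumℤ x ≡ sum (lookup x)
sumℤ≡sum []      = refl
sumℤ≡sum (a ∷ x) = cong (_+_ a) (sumℤ≡sum x)

dot-comm : ∀ x y → dot x y ≡ dot y x
dot-comm x y = trans (dot≡sum x y)
  (trans (sum-cong-≗ (λ j → ℤP.*-comm (lookup x j) (lookup y j))) (sym (dot≡sum y x)))

dot-⊕ˡ : ∀ x y z → dot (x ⊕ y) z ≡ dot x z + dot y z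
dot-⊕ˡ x y z = begin
  dot (x ⊕ y) z                                 ≡⟨ dot≡sum (x ⊕ y) z ⟩
  sum (λ j → lookup (x ⊕ y) j * lookup z j)     ≡⟨ sum-cong-≗ distrib ⟩
  sum (λ j → xz j + yz j)                       ≡⟨ ∑-distrib-+ xz yz ⟩
  sum xz + sum yz                               ≡⟨ cong₂ _+_ (dot≡sum x z) (dot≡sum y z) ⟨
  dot x z + dot y z                             ∎
  where
  open ≡-Reasoning
  xz yz : Fin 8 → ℤ
  xz j = lookup x j * lookup z j
  yz j = lookup y j * lookup z j
  distrib : ∀ j → lookup (x ⊕ y) j * lookup z j ≡ xz j + yz j
  distrib j = trans (cong (_* lookup z j) (lookup-⊕ x y j)) (ℤP.*-distribʳ-+ (lookup z j) (lookup x j) (lookup y j))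

dot-scaleˡ : ∀ k x z → dot (scale k x) z ≡ k * dot x z
dot-scaleˡ k x z = begin
  dot (scale k x) z                                ≡⟨ dot≡sum (scale k x) z ⟩
  sum (λ j → lookup (scale k x) j * lookup z j)    ≡⟨ sum-cong-≗ assoc ⟩
  sum (λ j → k * (lookup x j * lookup z j))        ≡⟨ *-distribˡ-sum k (λ j → lookup x j * lookup z j) ⟨
  k * sum (λ j → lookup x j * lookup z j)          ≡⟨ cong (k *_) (dot≡sum x z) ⟨
  k * dot x z                                      ∎
  where
  open ≡-Reasoning
  assoc : ∀ j → lookup (scale k x) j * lookup z j ≡ k * (lookup x j * lookup z j)
  assoc j = trans (cong (_* lookup z j) (lookup-scale k x j)) (ℤP.*-assoc k (lookup x j) (lookup z j))

dot-⊖ˡ : ∀ x y z → dot (x ⊖ y) z ≡ dot x z - dot y z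
dot-⊖ˡ x y z = trans (dot-⊕ˡ x (scale (- + 1) y) z)
  (cong (_+_ (dot x z)) (trans (dot-scaleˡ (- + 1) y z) (ℤP.-1*i≡-i (dot y z))))

dot-0ᵥˡ : ∀ z → dot 0ᵥ z ≡ + 0
dot-0ᵥˡ z = trans (dot≡sum 0ᵥ z)
  (trans (sum-cong-≗ (λ j → cong (_* lookup z j) (lookup-0ᵥ j))) (sum-replicate-zero 8))

dot-vsumˡ : ∀ {n} (v : Fin n → V8) z → dot (vsum v) z ≡ sum (λ i → dot (v i) z)
dot-vsumˡ {zero}  v z = dot-0ᵥˡ z
dot-vsumˡ {suc n} v z = trans (dot-⊕ˡ (v zero) (vsum (v ∘ suc)) z)
  (cong (_+_ (dot (v zero) z)) (dot-vsumˡ (v ∘ suc) z))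

dot-⊕ʳ : ∀ x y z → dot z (x ⊕ y) ≡ dot z x + dot z y
dot-⊕ʳ x y z = trans (dot-comm z (x ⊕ y)) (trans (dot-⊕ˡ x y z) (cong₂ _+_ (dot-comm x z) (dot-comm y z)))

dot-scaleʳ : ∀ k x z → dot z (scale k x) ≡ k * dot z x
dot-scaleʳ k x z = trans (dot-comm z (scale k x)) (trans (dot-scaleˡ k x z) (cong (k *_) (dot-comm x z)))

dot-⊖ʳ : ∀ x y z → dot z (x ⊖ y) ≡ dot z x - dot z y
dot-⊖ʳ x y z = trans (dot-comm z (x ⊖ y)) (trans (dot-⊖ˡ x y z) (cong₂ _-_ (dot-comm x z) (dot-comm y z)))

dot-vsumʳ : ∀ {n} (v : Fin n → V8) z → dot z (vsum v) ≡ sum (λ i → dot z (v i))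
dot-vsumʳ v z = trans (dot-comm z (vsum v)) (trans (dot-vsumˡ v z) (sum-cong-≗ (λ i → dot-comm (v i) z)))

-- Parity and the lattice Λ

data Parity : ℤ → Set where
  even : ∀ q → Parity (q * + 2)
  odd  : ∀ q → Parity (q * + 2 + + 1)

parity : ∀ z → Parity z
parity z with ℤD.a≡a%n+[a/n]*n z (+ 2) | ℤD.n%d<d z (+ 2)
... | eq | lt with z ℤD.% + 2
... | 0           = subst Parity (sym (trans eq (ℤP.+-identityˡ ((z ℤD./ + 2) * + 2)))) (even (z ℤD./ + 2))
... | 1           = subst Parity (sym (trans eq (ℤP.+-comm (+ 1) ((z ℤD./ + 2) * + 2)))) (odd (z ℤD./ + 2))
... | suc (suc _) = ⊥-elim (ℕP.<⇒≱ lt (ℕ.s≤s (ℕ.s≤s ℕ.z≤n)))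

*-/ℕ-cancel : ∀ q d .{{_ : ℕ.NonZero d}} → (q * + d) ℤD./ℕ d ≡ q
*-/ℕ-cancel q d@(suc _) = sym (ℤP.i-j≡0⇒i≡j q Q (multiple-below-d (q - Q) (begin
  (q - Q) * + d               ≡⟨ lemma q Q (+ d) ⟩
  q * + d - Q * + d           ≡⟨ cong (_- Q * + d) (ℤD.a≡a%ℕn+[a/ℕn]*n (q * + d) d) ⟩
  + r + Q * + d - Q * + d     ≡⟨ cancel (+ r) (Q * + d) ⟩
  + r                         ∎)))
  where
  open ≡-Reasoning
  Q = (q * + d) ℤD./ℕ d
  r = (q * + d) ℤD.%ℕ d
  lemma : ∀ q Q d → (q - Q) * d ≡ q * d - Q * d
  lemma = solve-∀
  cancel : ∀ r s → r + s - s ≡ r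
  cancel = solve-∀
  multiple-below-d : ∀ z → z * + d ≡ + r → z ≡ + 0
  multiple-below-d (+ zero)  _  = refl
  multiple-below-d +[1+ m ]  eq = ⊥-elim (ℕP.<⇒≱ (ℤD.n%ℕd<d (q * + d) d)
    (subst (d ℕ.≤_) (ℤP.+-injective (trans (ℤP.pos-* (suc m) d) eq)) (ℕP.m≤n*m d (suc m))))
  multiple-below-d -[1+ m ]  ()

even+even : ∀ {a b} → + 2 ∣ a → + 2 ∣ b → + 2 ∣ a + b
even+even = Div.∣m∣n⇒∣m+n

even+odd : ∀ {a b} → + 2 ∣ a → + 2 ∣ b + + 1 → + 2 ∣ a + b + + 1
even+odd {a} {b} p q = subst (+ 2 ∣_) (sym (ℤP.+-assoc a b (+ 1))) (Div.∣m∣n⇒∣m+n p q)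

odd+even : ∀ {a b} → + 2 ∣ a + + 1 → + 2 ∣ b → + 2 ∣ a + b + + 1
odd+even {a} {b} p q = subst (λ c → + 2 ∣ c + + 1) (ℤP.+-comm b a) (even+odd q p)

odd+odd : ∀ {a b} → + 2 ∣ a + + 1 → + 2 ∣ b + + 1 → + 2 ∣ a + b
odd+odd {a} {b} p q = Div.∣m+n∣n⇒∣m (subst (+ 2 ∣_) (lemma a b) (Div.∣m∣n⇒∣m+n p q)) Div.∣-refl
  where
  lemma : ∀ a b → a + + 1 + (b + + 1) ≡ a + b + + 2
  lemma = solve-∀

odd*odd : ∀ q {a} → + 2 ∣ a + + 1 → + 2 ∣ (q * + 2 + + 1) * a + + 1
odd*odd q {a} 2∣a+1 = subst (+ 2 ∣_) (lemma q a)
  (Div.∣m∣n⇒∣m-n (Div.∣n⇒∣m*n (q * + 2 + + 1) 2∣a+1) (divides q refl))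
  where
  lemma : ∀ q a → (q * + 2 + + 1) * (a + + 1) - q * + 2 ≡ (q * + 2 + + 1) * a + + 1
  lemma = solve-∀

evens⇒ : ∀ {n} {x : Vec ℤ n} → All Even x → All (+ 2 ∣_) x
evens⇒ = All.map (λ {a} → ∣ᵤ⇒∣ {+ 2} {a})

evens⇐ : ∀ {n} {x : Vec ℤ n} → All (+ 2 ∣_) x → All Even x
evens⇐ = All.map (λ {a} → ∣⇒∣ᵤ {+ 2} {a})

odds⇒ : ∀ {n} {x : Vec ℤ n} → All Odd x → All (λ a → + 2 ∣ a + + 1) x
odds⇒ = All.map (λ {a} → ∣ᵤ⇒∣ {+ 2} {a + + 1})

odds⇐ : ∀ {n} {x : Vec ℤ n} → All (λ a → + 2 ∣ a + + 1) x → All Odd x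
odds⇐ = All.map (λ {a} → ∣⇒∣ᵤ {+ 2} {a + + 1})

All-⊕ : ∀ {P Q R : ℤ → Set} → (∀ a b → P a → Q b → R (a + b)) →
        ∀ {x y} → All P x → All Q y → All R (x ⊕ y)
All-⊕ {R = R} combine {x} {y} px qy =
  lookup⁻ λ j → subst R (sym (lookup-⊕ x y j)) (combine (lookup x j) (lookup y j) (lookup⁺ px j) (lookup⁺ qy j))

All-scale : ∀ {P Q : ℤ → Set} k → (∀ a → P a → Q (k * a)) → ∀ {x} → All P x → All Q (scale k x)
All-scale {Q = Q} k multiply {x} px =
  lookup⁻ λ j → subst Q (sym (lookup-scale k x j)) (multiply (lookup x j) (lookup⁺ px j))

sumℤ-⊕ : ∀ {n} (x y : Vec ℤ n) → sumℤ (zipWith _+_ x y) ≡ sumℤ x + sumℤ y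
sumℤ-⊕ []      []      = refl
sumℤ-⊕ (a ∷ x) (b ∷ y) = trans (cong (_+_ (a + b)) (sumℤ-⊕ x y)) (lemma a b (sumℤ x) (sumℤ y))
  where
  lemma : ∀ a b c d → a + b + (c + d) ≡ a + c + (b + d)
  lemma = solve-∀

sumℤ-scale : ∀ {n} k (x : Vec ℤ n) → sumℤ (V.map (k *_) x) ≡ k * sumℤ x
sumℤ-scale k []      = sym (ℤP.*-zeroʳ k)
sumℤ-scale k (a ∷ x) = trans (cong (_+_ (k * a)) (sumℤ-scale k x)) (sym (ℤP.*-distribˡ-+ k a (sumℤ x)))

Λ-⊕ : ∀ {x y} → InΛ x → InΛ y → InΛ (x ⊕ y)
Λ-⊕ {x} {y} (px , 4∣x) (py , 4∣y) = sumParity px py ,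
  ∣⇒∣ᵤ {+ 4} {sumℤ (x ⊕ y)} (subst (+ 4 ∣_) (sym (sumℤ-⊕ x y))
    (Div.∣m∣n⇒∣m+n (∣ᵤ⇒∣ {+ 4} {sumℤ x} 4∣x) (∣ᵤ⇒∣ {+ 4} {sumℤ y} 4∣y)))
  where
  sumParity : All Even x ⊎ All Odd x → All Even y ⊎ All Odd y → All Even (x ⊕ y) ⊎ All Odd (x ⊕ y)
  sumParity (inj₁ ex) (inj₁ ey) = inj₁ (evens⇐ (All-⊕ (λ a b → even+even {a} {b}) (evens⇒ ex) (evens⇒ ey)))
  sumParity (inj₁ ex) (inj₂ oy) = inj₂ (odds⇐ (All-⊕ (λ a b → even+odd {a} {b}) (evens⇒ ex) (odds⇒ oy)))
  sumParity (inj₂ ox) (inj₁ ey) = inj₂ (odds⇐ (All-⊕ (λ a b → odd+even {a} {b}) (odds⇒ ox) (evens⇒ ey)))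
  sumParity (inj₂ ox) (inj₂ oy) = inj₁ (evens⇐ (All-⊕ (λ a b → odd+odd {a} {b}) (odds⇒ ox) (odds⇒ oy)))

Λ-scale : ∀ k {x} → InΛ x → InΛ (scale k x)
Λ-scale k {x} (px , 4∣x) = scaleParity (parity k) px ,
  ∣⇒∣ᵤ {+ 4} {sumℤ (scale k x)} (subst (+ 4 ∣_) (sym (sumℤ-scale k x)) (Div.∣n⇒∣m*n k (∣ᵤ⇒∣ {+ 4} {sumℤ x} 4∣x)))
  where
  scaleParity : ∀ {k} → Parity k → All Even x ⊎ All Odd x → All Even (scale k x) ⊎ All Odd (scale k x)
  scaleParity (even q) _         = inj₁ (evens⇐ (lookup⁻ λ j →
    subst (+ 2 ∣_) (sym (lookup-scale (q * + 2) x j)) (Div.∣m⇒∣m*n (lookup x j) (divides q refl))))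
  scaleParity (odd q)  (inj₁ ex) = inj₁ (evens⇐ (All-scale (q * + 2 + + 1) (λ a → Div.∣n⇒∣m*n (q * + 2 + + 1) {a}) (evens⇒ ex)))
  scaleParity (odd q)  (inj₂ ox) = inj₂ (odds⇐ (All-scale (q * + 2 + + 1) (λ a → odd*odd q {a}) (odds⇒ ox)))

Λ-0ᵥ : InΛ 0ᵥ
Λ-0ᵥ = inj₁ (evens⇐ (lookup⁻ λ j → divides (+ 0) (lookup-0ᵥ j))) , ∣⇒∣ᵤ {+ 4} {+ 0} (divides (+ 0) refl)

Λ-vsum : ∀ {n} (v : Fin n → V8) → (∀ i → InΛ (v i)) → InΛ (vsum v)
Λ-vsum {zero}  v vΛ = Λ-0ᵥ
Λ-vsum {suc n} v vΛ = Λ-⊕ (vΛ zero) (Λ-vsum (v ∘ suc) (vΛ ∘ suc))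

Λ-⊖ : ∀ {x y} → InΛ x → InΛ y → InΛ (x ⊖ y)
Λ-⊖ xΛ yΛ = Λ-⊕ xΛ (Λ-scale (- + 1) yΛ)

∣-sum-congruent : ∀ {k n} (f g : Fin n → ℤ) → (∀ i → k ∣ f i - g i) → k ∣ sum f - sum g
∣-sum-congruent {n = zero}  f g _   = divides (+ 0) refl
∣-sum-congruent {n = suc n} f g f≡g = subst (_ ∣_) (lemma (f zero) (g zero) (sum (f ∘ suc)) (sum (g ∘ suc)))
  (Div.∣m∣n⇒∣m+n (f≡g zero) (∣-sum-congruent (f ∘ suc) (g ∘ suc) (f≡g ∘ suc)))
  where
  lemma : ∀ a b c d → a - b + (c - d) ≡ a + c - (b + d)
  lemma = solve-∀

∣-congruent : ∀ {k a b} → k ∣ a - b → k ∣ b → k ∣ a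
∣-congruent {a = a} {b} k∣a-b k∣b = subst (_ ∣_) (lemma a b) (Div.∣m∣n⇒∣m+n k∣a-b k∣b)
  where
  lemma : ∀ a b → a - b + b ≡ a
  lemma = solve-∀

8∣4q[q-1] : ∀ q → + 8 ∣ + 4 * (q * (q - + 1))
8∣4q[q-1] q with parity q
... | even r = divides (r * (r * + 2 - + 1)) (lemma r)
  where
  lemma : ∀ r → + 4 * (r * + 2 * (r * + 2 - + 1)) ≡ r * (r * + 2 - + 1) * + 8
  lemma = solve-∀
... | odd r  = divides ((r * + 2 + + 1) * r) (lemma r)
  where
  lemma : ∀ r → + 4 * ((r * + 2 + + 1) * (r * + 2 + + 1 - + 1)) ≡ (r * + 2 + + 1) * r * + 8
  lemma = solve-∀

square-even : ∀ a → + 2 ∣ a → + 8 ∣ a * a - + 2 * a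
square-even a (divides r refl) = subst (+ 8 ∣_) (lemma r) (8∣4q[q-1] r)
  where
  lemma : ∀ r → + 4 * (r * (r - + 1)) ≡ r * + 2 * (r * + 2) - + 2 * (r * + 2)
  lemma = solve-∀

square-odd : ∀ a → + 2 ∣ a + + 1 → + 8 ∣ a * a - + 1
square-odd a (divides r a+1≡2r) = subst (+ 8 ∣_) (begin
  + 4 * (r * (r - + 1))                        ≡⟨ lemma r ⟩
  (r * + 2 - + 1) * (r * + 2 - + 1) - + 1      ≡⟨ cong (λ u → (u - + 1) * (u - + 1) - + 1) a+1≡2r ⟨
  (a + + 1 - + 1) * (a + + 1 - + 1) - + 1      ≡⟨ shift a ⟩
  a * a - + 1                                  ∎) (8∣4q[q-1] r)
  where
  open ≡-Reasoning
  lemma : ∀ r → + 4 * (r * (r - + 1)) ≡ (r * + 2 - + 1) * (r * + 2 - + 1) - + 1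
  lemma = solve-∀
  shift : ∀ a → (a + + 1 - + 1) * (a + + 1 - + 1) - + 1 ≡ a * a - + 1
  shift = solve-∀

norm-div8 : ∀ {x} → InΛ x → + 8 ∣ dot x x
norm-div8 {x} (inj₁ evens , 4∣Σx) = subst (+ 8 ∣_) (sym (dot≡sum x x)) (∣-congruent
  (∣-sum-congruent (λ j → lookup x j * lookup x j) (λ j → + 2 * lookup x j) λ j → square-even (lookup x j) (lookup⁺ (evens⇒ evens) j))
  (subst (+ 8 ∣_) (trans (cong (+ 2 *_) (sumℤ≡sum x)) (*-distribˡ-sum (+ 2) (lookup x)))
    (Div.*-monoʳ-∣ (+ 2) (∣ᵤ⇒∣ {+ 4} {sumℤ x} 4∣Σx))))
norm-div8 {x} (inj₂ odds , _) = subst (+ 8 ∣_) (sym (dot≡sum x x)) (∣-congruent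
  (∣-sum-congruent (λ j → lookup x j * lookup x j) (λ _ → + 1) λ j → square-odd (lookup x j) (lookup⁺ (odds⇒ odds) j))
  Div.∣-refl)

dot-exp : ∀ x y → dot (x ⊕ y) (x ⊕ y) ≡ dot x x + + 2 * dot x y + dot y y
dot-exp x y = begin
  dot (x ⊕ y) (x ⊕ y)                         ≡⟨ dot-⊕ˡ x y (x ⊕ y) ⟩
  dot x (x ⊕ y) + dot y (x ⊕ y)               ≡⟨ cong₂ _+_ (dot-⊕ʳ x y x) (dot-⊕ʳ x y y) ⟩
  dot x x + dot x y + (dot y x + dot y y)     ≡⟨ cong (λ c → dot x x + dot x y + (c + dot y y)) (dot-comm y x) ⟩
  dot x x + dot x y + (dot x y + dot y y)     ≡⟨ lemma (dot x x) (dot x y) (dot y y) ⟩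
  dot x x + + 2 * dot x y + dot y y           ∎
  where
  open ≡-Reasoning
  lemma : ∀ a b c → a + b + (b + c) ≡ a + + 2 * b + c
  lemma = solve-∀

dot-div4 : ∀ {x y} → InΛ x → InΛ y → + 4 ∣ dot x y
dot-div4 {x} {y} xΛ yΛ = Div.*-cancelˡ-∣ (+ 2) (subst (+ 8 ∣_) (lemma (dot x x) (dot x y) (dot y y))
  (Div.∣m∣n⇒∣m-n (Div.∣m∣n⇒∣m-n 8∣‖x+y‖ (norm-div8 xΛ)) (norm-div8 yΛ)))
  where
  8∣‖x+y‖ : + 8 ∣ dot x x + + 2 * dot x y + dot y y
  8∣‖x+y‖ = subst (+ 8 ∣_) (dot-exp x y) (norm-div8 (Λ-⊕ xΛ yΛ))
  lemma : ∀ a b c → a + + 2 * b + c - a - c ≡ + 2 * b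
  lemma = solve-∀

-- In true coordinates: a vector of norm 4 is not twice a lattice vector, as lattice norms are even.
norm16⇒∉2Λ : ∀ {c} → dot c c ≡ + 16 → ¬ In2Λ c
norm16⇒∉2Λ {c} ‖c‖≡16 (y , yΛ , refl) = ℕP.<⇒≱ 4<8 (ℕDiv.∣⇒≤ (∣⇒∣ᵤ (subst (+ 8 ∣_) ‖y‖≡4 (norm-div8 yΛ))))
  where
  4<8 : 4 ℕ.< 8
  4<8 = ℕP.m≤m+n 5 3
  ‖y‖≡4 : dot y y ≡ + 4
  ‖y‖≡4 = ℤP.*-cancelˡ-≡ (+ 4) (dot y y) (+ 4) (begin
    + 4 * dot y y               ≡⟨ ℤP.*-assoc (+ 2) (+ 2) (dot y y) ⟩
    + 2 * (+ 2 * dot y y)       ≡⟨ cong (+ 2 *_) (dot-scaleʳ (+ 2) y y) ⟨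
    + 2 * dot y (twice y)       ≡⟨ dot-scaleˡ (+ 2) y (twice y) ⟨
    dot (twice y) (twice y)     ≡⟨ ‖c‖≡16 ⟩
    + 16                        ∎)
    where open ≡-Reasoning

-- Automorphisms of Λ

module _ (w : AutΛ) where
  open AutΛ w

  AutΛ-0ᵥ : map 0ᵥ ≡ 0ᵥ
  AutΛ-0ᵥ = lookup-ext λ j → trans (idempotent (lookup (map 0ᵥ) j) (begin
    lookup (map 0ᵥ) j                           ≡⟨ cong (λ v → lookup v j) (additive 0ᵥ 0ᵥ Λ-0ᵥ Λ-0ᵥ) ⟩
    lookup (map 0ᵥ ⊕ map 0ᵥ) j                  ≡⟨ lookup-⊕ (map 0ᵥ) (map 0ᵥ) j ⟩
    lookup (map 0ᵥ) j + lookup (map 0ᵥ) j       ∎)) (sym (lookup-0ᵥ j))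
    where
    open ≡-Reasoning
    idempotent : ∀ a → a ≡ a + a → a ≡ + 0
    idempotent a a≡2a = sym (trans (sym (ℤP.+-inverseʳ a)) (trans (cong (_- a) a≡2a) (lemma a)))
      where
      lemma : ∀ a → a + a - a ≡ a
      lemma = solve-∀

  AutΛ-vsum : ∀ {n} (v : Fin n → V8) → (∀ i → InΛ (v i)) → map (vsum v) ≡ vsum (map ∘ v)
  AutΛ-vsum {zero}  v vΛ = AutΛ-0ᵥ
  AutΛ-vsum {suc n} v vΛ = trans (additive (v zero) (vsum (v ∘ suc)) (vΛ zero) (Λ-vsum (v ∘ suc) (vΛ ∘ suc)))
    (cong (_⊕_ (map (v zero))) (AutΛ-vsum (v ∘ suc) (vΛ ∘ suc)))

  AutΛ-twice : ∀ {y} → InΛ y → map (twice y) ≡ twice (map y)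
  AutΛ-twice {y} yΛ = trans (cong map (twice≡⊕ y)) (trans (additive y y yΛ yΛ) (sym (twice≡⊕ (map y))))

  AutΛ-2Λ : ∀ {x} → InΛ x → In2Λ x ⇔ In2Λ (map x)
  AutΛ-2Λ {x} xΛ = mk⇔ forth back
    where
    forth : In2Λ x → In2Λ (map x)
    forth (y , yΛ , x≡2y) = map y , closed y yΛ , trans (cong map x≡2y) (AutΛ-twice yΛ)
    back : In2Λ (map x) → In2Λ x
    back (y′ , y′Λ , mx≡2y′) = preimage (surjective y′ y′Λ)
      where
      preimage : (Σ V8 λ y → InΛ y × map y ≡ y′) → In2Λ x
      preimage (y , yΛ , my≡y′) = y , yΛ , injective x (twice y) xΛ (Λ-scale (+ 2) yΛ)
        (trans mx≡2y′ (trans (cong twice (sym my≡y′)) (sym (AutΛ-twice yΛ))))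

  AutΛ-vsum-2Λ : ∀ {n} (v : Fin n → V8) → (∀ i → InΛ (v i)) → In2Λ (vsum v) ⇔ In2Λ (vsum (map ∘ v))
  AutΛ-vsum-2Λ v vΛ = subst (λ u → In2Λ (vsum v) ⇔ In2Λ u) (AutΛ-vsum v vΛ) (AutΛ-2Λ {vsum v} (Λ-vsum v vΛ))

-- Linear dependence and orthogonal frames

Dependence : ∀ {m n} → (Fin m → Fin n → ℤ) → Set
Dependence {m} v = Σ (Fin m → ℤ) λ c → (∃ λ k → c k ≢ + 0) × (∀ j → sum (λ k → c k * v k j) ≡ + 0)

dependence-zero-column : ∀ {n} (v : Fin (suc (suc n)) → Fin (suc n) → ℤ) → (∀ k → v k zero ≡ + 0) →
                         Dependence (λ k j → v (suc k) (suc j)) → Dependence v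
dependence-zero-column {n} v column≡0 (c , (k , c≢0) , rel) = insertAt c zero (+ 0) , (suc k , c≢0) , rel′
  where
  rel′ : ∀ j → sum (λ k → insertAt c zero (+ 0) k * v k j) ≡ + 0
  rel′ zero    = begin
    + 0 * v zero zero + sum (λ k → c k * v (suc k) zero) ≡⟨ ℤP.+-identityˡ _ ⟩
    sum (λ k → c k * v (suc k) zero)                    ≡⟨ sum-cong-≗ (λ k → trans (cong (c k *_) (column≡0 (suc k))) (ℤP.*-zeroʳ (c k))) ⟩
    sum {suc n} (λ _ → + 0)                             ≡⟨ sum-replicate-zero (suc n) ⟩
    + 0                                                 ∎
    where open ≡-Reasoning
  rel′ (suc j) = trans (ℤP.+-identityˡ _) (rel j)

-- Row p, whose first entry h is nonzero, clears the first column of the other rows.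
dependence-pivot : ∀ {n} (v : Fin (suc (suc n)) → Fin (suc n) → ℤ) p → v p zero ≢ + 0 →
                   let h = v p zero; q = punchIn p in
                   Dependence (λ k j → h * v (q k) (suc j) - v (q k) zero * v p (suc j)) → Dependence v
dependence-pivot v p h≢0 (c , (k , c≢0) , rel) = c′ , (punchIn p k , c′≢0) , rel′
  where
  h = v p zero
  q = punchIn p
  S : Fin _ → ℤ
  S j = sum (λ k → c k * v (q k) j)
  c′ = insertAt (λ k → h * c k) p (- S zero)
  c′≢0 : c′ (q k) ≢ + 0
  c′≢0 eq with ℤP.i*j≡0⇒i≡0∨j≡0 h (trans (sym (insertAt-punchIn (λ k → h * c k) p (- S zero) k)) eq)
  ... | inj₁ h≡0 = h≢0 h≡0
  ... | inj₂ c≡0 = c≢0 c≡0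
  split : ∀ j → sum (λ k → c′ k * v k j) ≡ - S zero * v p j + h * S j
  split j = begin
    sum (λ k → c′ k * v k j)                          ≡⟨ sum-remove (λ k → c′ k * v k j) ⟩
    c′ p * v p j + sum (λ k → c′ (q k) * v (q k) j)   ≡⟨ cong₂ _+_ (cong (_* v p j) (insertAt-lookup (λ k → h * c k) p (- S zero)))
                                                          (sum-cong-≗ λ k → trans (cong (_* v (q k) j) (insertAt-punchIn (λ k → h * c k) p (- S zero) k))
                                                                                  (ℤP.*-assoc h (c k) (v (q k) j))) ⟩
    - S zero * v p j + sum (λ k → h * (c k * v (q k) j)) ≡⟨ cong (_+_ (- S zero * v p j)) (*-distribˡ-sum h (λ k → c k * v (q k) j)) ⟨
    - S zero * v p j + h * S j                        ∎
    where open ≡-Reasoning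
  eliminated : ∀ j → sum (λ k → c k * (h * v (q k) (suc j) - v (q k) zero * v p (suc j))) ≡ - S zero * v p (suc j) + h * S (suc j)
  eliminated j = begin
    sum (λ k → c k * (h * v (q k) (suc j) - v (q k) zero * d))
      ≡⟨ sum-cong-≗ (λ k → regroup (c k) h (v (q k) (suc j)) (v (q k) zero) d) ⟩
    sum (λ k → h * (c k * v (q k) (suc j)) + c k * v (q k) zero * - d)
      ≡⟨ ∑-distrib-+ (λ k → h * (c k * v (q k) (suc j))) (λ k → c k * v (q k) zero * - d) ⟩
    sum (λ k → h * (c k * v (q k) (suc j))) + sum (λ k → c k * v (q k) zero * - d)
      ≡⟨ cong₂ _+_ (*-distribˡ-sum h (λ k → c k * v (q k) (suc j))) (*-distribʳ-sum (- d) (λ k → c k * v (q k) zero)) ⟨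
    h * S (suc j) + S zero * - d
      ≡⟨ swap h (S (suc j)) (S zero) d ⟩
    - S zero * d + h * S (suc j)
      ∎
    where
    open ≡-Reasoning
    d = v p (suc j)
    regroup : ∀ c h a b d → c * (h * a - b * d) ≡ h * (c * a) + c * b * - d
    regroup = solve-∀
    swap : ∀ h s₁ s₀ d → h * s₁ + s₀ * - d ≡ - s₀ * d + h * s₁
    swap = solve-∀
  rel′ : ∀ j → sum (λ k → c′ k * v k j) ≡ + 0
  rel′ zero    = trans (split zero) (cancel (S zero) h)
    where
    cancel : ∀ s h → - s * h + h * s ≡ + 0
    cancel = solve-∀
  rel′ (suc j) = trans (split (suc j)) (trans (sym (eliminated j)) (rel j))

dependent : ∀ n (v : Fin (suc n) → Fin n → ℤ) → Dependence v
dependent zero    v = (λ _ → + 1) , (zero , λ ()) , λ ()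
dependent (suc n) v with FinP.any? (λ k → ¬? (v k zero ℤ.≟ + 0))
... | yes (p , h≢0) = dependence-pivot v p h≢0
  (dependent n (λ k j → v p zero * v (punchIn p k) (suc j) - v (punchIn p k) zero * v p (suc j)))
... | no  noPivot   = dependence-zero-column v column≡0 (dependent n (λ k j → v (suc k) (suc j)))
  where
  column≡0 : ∀ k → v k zero ≡ + 0
  column≡0 k with v k zero ℤ.≟ + 0
  ... | yes eq  = eq
  ... | no  neq = ⊥-elim (noPivot (k , neq))

record IsOrthogonalFrame (ν : ℕ) (B : Fin 8 → V8) : Set where
  field
    norm       : ∀ k → dot (B k) (B k) ≡ + ν
    orthogonal : ∀ k l → k ≢ l → dot (B k) (B l) ≡ + 0

module OrthogonalFrame {ν B} (frame : IsOrthogonalFrame ν B) .{{_ : ℕ.NonZero ν}} where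
  open IsOrthogonalFrame frame

  combination : (Fin 8 → ℤ) → V8
  combination a = vsum (λ k → scale (a k) (B k))

  dot-combination : ∀ a l → dot (combination a) (B l) ≡ a l * + ν
  dot-combination a l = begin
    dot (combination a) (B l)                  ≡⟨ dot-vsumˡ (λ k → scale (a k) (B k)) (B l) ⟩
    sum (λ k → dot (scale (a k) (B k)) (B l))  ≡⟨ sum-cong-≗ (λ k → dot-scaleˡ (a k) (B k) (B l)) ⟩
    sum (λ k → a k * dot (B k) (B l))          ≡⟨ sum-supported (λ k → a k * dot (B k) (B l)) l off-diagonal ⟩
    a l * dot (B l) (B l)                      ≡⟨ cong (a l *_) (norm l) ⟩
    a l * + ν                                  ∎
    where
    open ≡-Reasoning
    off-diagonal : ∀ k → k ≢ l → a k * dot (B k) (B l) ≡ + 0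
    off-diagonal k k≢l = trans (cong (a k *_) (orthogonal k l k≢l)) (ℤP.*-zeroʳ (a k))

  private
    rows : V8 → Fin 9 → Fin 8 → ℤ
    rows y zero    = lookup y
    rows y (suc k) = lookup (B k)

  -- Dotting a dependence c₀ y + Σ cₖ₊₁ Bₖ = 0 with B m forces cₘ₊₁ = 0, so c₀ ≠ 0 and y = 0.
  module _ {y : V8} (y⊥B : ∀ k → dot y (B k) ≡ + 0)
           (c : Fin 9 → ℤ) (rel : ∀ j → sum (λ k → c k * rows y k j) ≡ + 0) where
    private
      relation : scale (c zero) y ⊕ combination (c ∘ suc) ≡ 0ᵥ
      relation = lookup-ext λ j → begin
        lookup (scale (c zero) y ⊕ combination (c ∘ suc)) j                 ≡⟨ lookup-⊕ (scale (c zero) y) (combination (c ∘ suc)) j ⟩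
        lookup (scale (c zero) y) j + lookup (combination (c ∘ suc)) j     ≡⟨ cong₂ _+_ (lookup-scale (c zero) y j) (lookup-vsum-scale (c ∘ suc) B j) ⟩
        c zero * lookup y j + sum (λ k → c (suc k) * lookup (B k) j)       ≡⟨ rel j ⟩
        + 0                                                                ≡⟨ lookup-0ᵥ j ⟨
        lookup 0ᵥ j                                                        ∎
        where open ≡-Reasoning

      frame-coefficient≡0 : ∀ m → c (suc m) ≡ + 0
      frame-coefficient≡0 m = ℤP.*-cancelʳ-≡ (c (suc m)) (+ 0) (+ ν) (begin
        c (suc m) * + ν                                                     ≡⟨ ℤP.+-identityˡ _ ⟨
        + 0 + c (suc m) * + ν
          ≡⟨ cong₂ _+_ (trans (cong (c zero *_) (y⊥B m)) (ℤP.*-zeroʳ (c zero))) (dot-combination (c ∘ suc) m) ⟨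
        c zero * dot y (B m) + dot (combination (c ∘ suc)) (B m)
          ≡⟨ cong (_+ dot (combination (c ∘ suc)) (B m)) (dot-scaleˡ (c zero) y (B m)) ⟨
        dot (scale (c zero) y) (B m) + dot (combination (c ∘ suc)) (B m)  ≡⟨ dot-⊕ˡ (scale (c zero) y) (combination (c ∘ suc)) (B m) ⟨
        dot (scale (c zero) y ⊕ combination (c ∘ suc)) (B m)              ≡⟨ cong (λ r → dot r (B m)) relation ⟩
        dot 0ᵥ (B m)                                                      ≡⟨ dot-0ᵥˡ (B m) ⟩
        + 0                                                               ∎)
        where open ≡-Reasoning

      y-coefficient≢0 : ∀ k → c k ≢ + 0 → c zero ≢ + 0
      y-coefficient≢0 zero    c≢0 = c≢0
      y-coefficient≢0 (suc m) c≢0 = ⊥-elim (c≢0 (frame-coefficient≡0 m))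

      frame-part≡0 : ∀ j → sum (λ k → c (suc k) * lookup (B k) j) ≡ + 0
      frame-part≡0 j = trans (sum-cong-≗ {8} {λ k → c (suc k) * lookup (B k) j} {λ _ → + 0}
                               (λ k → cong (_* lookup (B k) j) (frame-coefficient≡0 k)))
                             (sum-replicate-zero 8)

      scaled-coordinate≡0 : ∀ j → c zero * lookup y j ≡ + 0
      scaled-coordinate≡0 j = begin
        c zero * lookup y j                                           ≡⟨ ℤP.+-identityʳ (c zero * lookup y j) ⟨
        c zero * lookup y j + + 0                                     ≡⟨ cong (_+_ (c zero * lookup y j)) (frame-part≡0 j) ⟨
        c zero * lookup y j + sum (λ k → c (suc k) * lookup (B k) j)  ≡⟨ rel j ⟩
        + 0                                                           ∎
        where open ≡-Reasoning

    coordinate≡0 : ∀ k → c k ≢ + 0 → ∀ j → lookup y j ≡ + 0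
    coordinate≡0 k c≢0 j = [ (λ c₀≡0 → ⊥-elim (y-coefficient≢0 k c≢0 c₀≡0)) , (λ yⱼ≡0 → yⱼ≡0) ]′
      (ℤP.i*j≡0⇒i≡0∨j≡0 (c zero) {lookup y j} (scaled-coordinate≡0 j))

  orthogonal⇒≡0 : ∀ y → (∀ k → dot y (B k) ≡ + 0) → ∀ j → lookup y j ≡ + 0
  orthogonal⇒≡0 y y⊥B = let c , (k , c≢0) , rel = dependent 8 (rows y) in coordinate≡0 {y} y⊥B c rel k c≢0

  frame-ext : ∀ u w → (∀ k → dot u (B k) ≡ dot w (B k)) → u ≡ w
  frame-ext u w u≈w = lookup-ext λ j → ℤP.i-j≡0⇒i≡j (lookup u j) (lookup w j)
    (trans (sym (lookup-⊖ u w j)) (orthogonal⇒≡0 (u ⊖ w) u-w⊥B j))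
    where
    u-w⊥B : ∀ k → dot (u ⊖ w) (B k) ≡ + 0
    u-w⊥B k = trans (dot-⊖ˡ u w (B k)) (trans (cong (_- dot w (B k)) (u≈w k)) (ℤP.+-inverseʳ (dot w (B k))))

  coordinates : V8 → Fin 8 → ℤ
  coordinates x k = dot x (B k)

  expansion : ∀ x → scale (+ ν) x ≡ combination (coordinates x)
  expansion x = frame-ext (scale (+ ν) x) (combination (coordinates x)) λ l →
    trans (dot-scaleˡ (+ ν) x (B l)) (trans (ℤP.*-comm (+ ν) (dot x (B l))) (sym (dot-combination (coordinates x) l)))

  dot-via-coordinates : ∀ x y → + ν * dot x y ≡ sum (λ k → coordinates x k * coordinates y k)
  dot-via-coordinates x y = begin
    + ν * dot x y                                          ≡⟨ dot-scaleʳ (+ ν) y x ⟨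
    dot x (scale (+ ν) y)                                  ≡⟨ cong (dot x) (expansion y) ⟩
    dot x (combination (coordinates y))                    ≡⟨ dot-vsumʳ (λ k → scale (coordinates y k) (B k)) x ⟩
    sum (λ k → dot x (scale (coordinates y k) (B k)))      ≡⟨ sum-cong-≗ (λ k → trans (dot-scaleʳ (coordinates y k) (B k) x)
                                                                                    (ℤP.*-comm (coordinates y k) (coordinates x k))) ⟩
    sum (λ k → coordinates x k * coordinates y k)          ∎
    where open ≡-Reasoning

module FrameCorrespondence {ν B B′} (F : IsOrthogonalFrame ν B) (F′ : IsOrthogonalFrame ν B′) .{{_ : ℕ.NonZero ν}} where
  private
    module S = OrthogonalFrame F
    module T = OrthogonalFrame F′

  -- x ~ z: z has the coordinates in B′ that x has in B, i.e. z is the image of x under Bₖ ↦ B′ₖ.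
  Corresponds : V8 → V8 → Set
  Corresponds x z = ∀ k → dot x (B k) ≡ dot z (B′ k)

  corresponds-⊕ : ∀ {x y z w} → Corresponds x z → Corresponds y w → Corresponds (x ⊕ y) (z ⊕ w)
  corresponds-⊕ {x} {y} {z} {w} x~z y~w k =
    trans (dot-⊕ˡ x y (B k)) (trans (cong₂ _+_ (x~z k) (y~w k)) (sym (dot-⊕ˡ z w (B′ k))))

  corresponds-scale : ∀ a {x z} → Corresponds x z → Corresponds (scale a x) (scale a z)
  corresponds-scale a {x} {z} x~z k =
    trans (dot-scaleˡ a x (B k)) (trans (cong (a *_) (x~z k)) (sym (dot-scaleˡ a z (B′ k))))

  corresponds-half : ∀ {x z} → Corresponds (twice x) (twice z) → Corresponds x z
  corresponds-half {x} {z} 2x~2z k = ℤP.*-cancelˡ-≡ (+ 2) (dot x (B k)) (dot z (B′ k))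
    (trans (sym (dot-scaleˡ (+ 2) x (B k))) (trans (2x~2z k) (dot-scaleˡ (+ 2) z (B′ k))))

  corresponds-dot : ∀ {x x′ y y′} → Corresponds x x′ → Corresponds y y′ → dot x′ y′ ≡ dot x y
  corresponds-dot {x} {x′} {y} {y′} x~x′ y~y′ = ℤP.*-cancelˡ-≡ (+ ν) (dot x′ y′) (dot x y) (begin
    + ν * dot x′ y′                                            ≡⟨ T.dot-via-coordinates x′ y′ ⟩
    sum (λ k → T.coordinates x′ k * T.coordinates y′ k)        ≡⟨ sum-cong-≗ (λ k → cong₂ _*_ (x~x′ k) (y~y′ k)) ⟨
    sum (λ k → S.coordinates x k * S.coordinates y k)          ≡⟨ S.dot-via-coordinates x y ⟨
    + ν * dot x y                                              ∎)
    where open ≡-Reasoning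

  corresponds-injective : ∀ {x y z} → Corresponds x z → Corresponds y z → x ≡ y
  corresponds-injective {x} {y} x~z y~z = S.frame-ext x y (λ k → trans (x~z k) (sym (y~z k)))

  -- ν times the image is computed by expansion in B′; the division is exact whenever x has an image.
  transfer : V8 → V8
  transfer x = tabulate (λ j → lookup (T.combination (S.coordinates x)) j ℤD./ℕ ν)

  transfer-corresponds : ∀ {x z} → Corresponds x z → transfer x ≡ z
  transfer-corresponds {x} {z} x~z = lookup-ext λ j → begin
    lookup (transfer x) j                                   ≡⟨ VP.lookup∘tabulate (λ j → lookup (T.combination (S.coordinates x)) j ℤD./ℕ ν) j ⟩
    lookup (T.combination (S.coordinates x)) j ℤD./ℕ ν      ≡⟨ cong (λ v → lookup v j ℤD./ℕ ν) combination≡νz ⟩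
    lookup (scale (+ ν) z) j ℤD./ℕ ν                         ≡⟨ cong (ℤD._/ℕ ν) (trans (lookup-scale (+ ν) z j) (ℤP.*-comm (+ ν) (lookup z j))) ⟩
    (lookup z j * + ν) ℤD./ℕ ν                               ≡⟨ *-/ℕ-cancel (lookup z j) ν ⟩
    lookup z j                                              ∎
    where
    open ≡-Reasoning
    combination≡νz : T.combination (S.coordinates x) ≡ scale (+ ν) z
    combination≡νz = T.frame-ext (T.combination (S.coordinates x)) (scale (+ ν) z) λ k → begin
      dot (T.combination (S.coordinates x)) (B′ k)   ≡⟨ T.dot-combination (S.coordinates x) k ⟩
      dot x (B k) * + ν                             ≡⟨ cong (_* + ν) (x~z k) ⟩
      dot z (B′ k) * + ν                            ≡⟨ ℤP.*-comm (dot z (B′ k)) (+ ν) ⟩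
      + ν * dot z (B′ k)                            ≡⟨ dot-scaleˡ (+ ν) z (B′ k) ⟨
      dot (scale (+ ν) z) (B′ k)                    ∎

  module _ (forth : ∀ x → InΛ x → Σ V8 λ z → InΛ z × Corresponds x z)
           (back  : ∀ z → InΛ z → Σ V8 λ x → InΛ x × Corresponds x z) where
    private
      corresponds-transfer : ∀ {x} → InΛ x → Corresponds x (transfer x)
      corresponds-transfer {x} xΛ = let z , _ , x~z = forth x xΛ in
        subst (Corresponds x) (sym (transfer-corresponds {x} {z} x~z)) x~z

    automorphism : AutΛ
    automorphism = record
      { map        = transfer
      ; closed     = λ x xΛ → let z , zΛ , x~z = forth x xΛ in subst InΛ (sym (transfer-corresponds {x} {z} x~z)) zΛ
      ; additive   = λ x y xΛ yΛ → transfer-corresponds {x ⊕ y} {transfer x ⊕ transfer y}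
                                     (corresponds-⊕ {x} {y} {transfer x} {transfer y} (corresponds-transfer xΛ) (corresponds-transfer yΛ))
      ; isometry   = λ x y xΛ yΛ → corresponds-dot {x} {transfer x} {y} {transfer y} (corresponds-transfer xΛ) (corresponds-transfer yΛ)
      ; injective  = λ x y xΛ yΛ tx≡ty → corresponds-injective {x} {y} {transfer x} (corresponds-transfer xΛ)
                                           (subst (Corresponds y) (sym tx≡ty) (corresponds-transfer yΛ))
      ; surjective = λ z zΛ → let x , xΛ , x~z = back z zΛ in x , xΛ , transfer-corresponds {x} {z} x~z
      }

-- The frame of a 7-crosspolytope

e-clique : Fin 7 → Idx
e-clique = inj₁

fe-clique : Fin 7 → Idx
fe-clique zero    = inj₂ zero
fe-clique (suc i) = inj₁ (suc i)

module CrossFrame {e f : Fin 7 → V8} (cp : IsCrossPolytope e f) where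
  open IsCrossPolytope cp

  C : V8
  C = e zero ⊕ f zero

  D : Fin 7 → V8
  D i = e i ⊖ f i

  B : Fin 8 → V8
  B zero    = C
  B (suc i) = D i

  Λ-e : ∀ i → InΛ (e i)
  Λ-e i = proj₁ (roots (inj₁ i))

  Λ-f : ∀ i → InΛ (f i)
  Λ-f i = proj₁ (roots (inj₂ i))

  Λ-C : InΛ C
  Λ-C = Λ-⊕ (Λ-e zero) (Λ-f zero)

  private
    ‖e‖ : ∀ i → dot (e i) (e i) ≡ + 8
    ‖e‖ i = proj₂ (roots (inj₁ i))

    ‖f‖ : ∀ i → dot (f i) (f i) ≡ + 8
    ‖f‖ i = proj₂ (roots (inj₂ i))

    fe0 : ∀ i → dot (f i) (e i) ≡ + 0
    fe0 i = trans (dot-comm (f i) (e i)) (ef0 i)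

    fe1 : ∀ i k → i ≢ k → dot (f i) (e k) ≡ + 4
    fe1 i k i≢k = trans (dot-comm (f i) (e k)) (ef1 k i (i≢k ∘ sym))

  e·C : ∀ i → dot (e i) C ≡ + 8
  e·C zero    = trans (dot-⊕ʳ (e zero) (f zero) (e zero)) (cong₂ _+_ (‖e‖ zero) (ef0 zero))
  e·C (suc i) = trans (dot-⊕ʳ (e zero) (f zero) (e (suc i))) (cong₂ _+_ (ee1 (suc i) zero λ ()) (ef1 (suc i) zero λ ()))

  f·C : ∀ i → dot (f i) C ≡ + 8
  f·C zero    = trans (dot-⊕ʳ (e zero) (f zero) (f zero)) (cong₂ _+_ (fe0 zero) (‖f‖ zero))
  f·C (suc i) = trans (dot-⊕ʳ (e zero) (f zero) (f (suc i))) (cong₂ _+_ (fe1 (suc i) zero λ ()) (ff1 (suc i) zero λ ()))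

  e·D≡8 : ∀ i → dot (e i) (D i) ≡ + 8
  e·D≡8 i = trans (dot-⊖ʳ (e i) (f i) (e i)) (cong₂ _-_ (‖e‖ i) (ef0 i))

  e·D≡0 : ∀ i k → i ≢ k → dot (e i) (D k) ≡ + 0
  e·D≡0 i k i≢k = trans (dot-⊖ʳ (e k) (f k) (e i)) (cong₂ _-_ (ee1 i k i≢k) (ef1 i k i≢k))

  f·D≡-8 : ∀ i → dot (f i) (D i) ≡ - + 8
  f·D≡-8 i = trans (dot-⊖ʳ (e i) (f i) (f i)) (cong₂ _-_ (fe0 i) (‖f‖ i))

  f·D≡0 : ∀ i k → i ≢ k → dot (f i) (D k) ≡ + 0
  f·D≡0 i k i≢k = trans (dot-⊖ʳ (e k) (f k) (f i)) (cong₂ _-_ (fe1 i k i≢k) (ff1 i k i≢k))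

  private
    C·D : ∀ k → dot C (D k) ≡ + 0
    C·D zero    = trans (dot-⊕ˡ (e zero) (f zero) (D zero)) (cong₂ _+_ (e·D≡8 zero) (f·D≡-8 zero))
    C·D (suc k) = trans (dot-⊕ˡ (e zero) (f zero) (D (suc k))) (cong₂ _+_ (e·D≡0 zero (suc k) λ ()) (f·D≡0 zero (suc k) λ ()))

  frame : IsOrthogonalFrame 16 B
  frame = record { norm = norm ; orthogonal = orthogonal }
    where
    norm : ∀ k → dot (B k) (B k) ≡ + 16
    norm zero    = trans (dot-⊕ˡ (e zero) (f zero) C) (cong₂ _+_ (e·C zero) (f·C zero))
    norm (suc i) = trans (dot-⊖ˡ (e i) (f i) (D i)) (cong₂ _-_ (e·D≡8 i) (f·D≡-8 i))
    orthogonal : ∀ k l → k ≢ l → dot (B k) (B l) ≡ + 0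
    orthogonal zero    zero    k≢l = ⊥-elim (k≢l refl)
    orthogonal zero    (suc l) _   = C·D l
    orthogonal (suc k) zero    _   = trans (dot-comm (D k) C) (C·D k)
    orthogonal (suc k) (suc l) k≢l = trans (dot-⊖ˡ (e k) (f k) (D l))
      (cong₂ _-_ (e·D≡0 k l (k≢l ∘ cong suc)) (f·D≡0 k l (k≢l ∘ cong suc)))

  open OrthogonalFrame frame using (frame-ext)

  centre : ∀ i → e i ⊕ f i ≡ C
  centre i = frame-ext (e i ⊕ f i) C same-coordinates
    where
    same-coordinates : ∀ k → dot (e i ⊕ f i) (B k) ≡ dot C (B k)
    same-coordinates zero    = trans (dot-⊕ˡ (e i) (f i) C) (trans (cong₂ _+_ (e·C i) (f·C i))
                                 (sym (trans (dot-⊕ˡ (e zero) (f zero) C) (cong₂ _+_ (e·C zero) (f·C zero)))))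
    same-coordinates (suc k) = trans (dot-⊕ˡ (e i) (f i) (D k)) (trans (e·D+f·D (i Fin.≟ k)) (sym (C·D k)))
      where
      e·D+f·D : Dec (i ≡ k) → dot (e i) (D k) + dot (f i) (D k) ≡ + 0
      e·D+f·D (yes refl) = cong₂ _+_ (e·D≡8 i) (f·D≡-8 i)
      e·D+f·D (no  i≢k)  = cong₂ _+_ (e·D≡0 i k i≢k) (f·D≡0 i k i≢k)

  -- With x·C = 4n and x·fᵢ = 4bᵢ the frame coordinates of 2x are 8n and 8(n − 2bᵢ);
  -- matching them forces the coefficient Σb − 3n of C.
  twice-expansion : ∀ {x} → + 4 ∣ dot x C → (∀ i → + 4 ∣ dot x (f i)) →
                    Σ ℤ λ t → Σ ℤ λ n → Σ (Fin 7 → ℤ) λ b → twice x ≡ scale t C ⊕ vsum (λ i → scale (n - + 2 * b i) (e i))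
  twice-expansion {x} (divides n x·C) 4∣x·f = t , n , b , frame-ext (twice x) R same-coordinates
    where
    open ≡-Reasoning
    b : Fin 7 → ℤ
    b i = Div.quotient (4∣x·f i)
    x·f : ∀ i → dot x (f i) ≡ b i * + 4
    x·f i = Div._∣_.equality (4∣x·f i)
    t : ℤ
    t = sum b - + 3 * n
    c : Fin 7 → ℤ
    c i = n - + 2 * b i
    R : V8
    R = scale t C ⊕ vsum (λ i → scale (c i) (e i))

    R·B : ∀ l → dot R (B l) ≡ t * dot C (B l) + sum (λ i → c i * dot (e i) (B l))
    R·B l = trans (dot-⊕ˡ (scale t C) (vsum (λ i → scale (c i) (e i))) (B l)) (cong₂ _+_ (dot-scaleˡ t C (B l))
      (trans (dot-vsumˡ (λ i → scale (c i) (e i)) (B l)) (sum-cong-≗ λ i → dot-scaleˡ (c i) (e i) (B l))))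

    same-coordinates : ∀ l → dot (twice x) (B l) ≡ dot R (B l)
    same-coordinates zero = begin
      dot (twice x) C                                ≡⟨ dot-scaleˡ (+ 2) x C ⟩
      + 2 * dot x C                                  ≡⟨ cong (+ 2 *_) x·C ⟩
      + 2 * (n * + 4)                                ≡⟨ lemma n (sum b) ⟩
      t * + 16 + (+ 7 * n - + 2 * sum b) * + 8       ≡⟨ cong₂ (λ u v → t * u + v * + 8) (IsOrthogonalFrame.norm frame zero) (sum-affine n (+ 2) b) ⟨
      t * dot C C + sum c * + 8                      ≡⟨ cong (_+_ (t * dot C C)) (*-distribʳ-sum (+ 8) c) ⟩
      t * dot C C + sum (λ i → c i * + 8)            ≡⟨ cong (_+_ (t * dot C C)) (sum-cong-≗ λ i → cong (c i *_) (e·C i)) ⟨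
      t * dot C C + sum (λ i → c i * dot (e i) C)    ≡⟨ R·B zero ⟨
      dot R C                                        ∎
      where
      lemma : ∀ n s → + 2 * (n * + 4) ≡ (s - + 3 * n) * + 16 + (+ 7 * n - + 2 * s) * + 8
      lemma = solve-∀
    same-coordinates (suc k) = begin
      dot (twice x) (D k)                                          ≡⟨ dot-scaleˡ (+ 2) x (D k) ⟩
      + 2 * dot x (D k)                                            ≡⟨ cong (+ 2 *_) (dot-⊖ʳ (e k) (f k) x) ⟩
      + 2 * (dot x (e k) - dot x (f k))                            ≡⟨ regroup (dot x (e k)) (dot x (f k)) ⟩
      + 2 * (dot x (e k) + dot x (f k) - + 2 * dot x (f k))        ≡⟨ cong₂ (λ s r → + 2 * (s - + 2 * r)) x·[e+f] (x·f k) ⟩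
      + 2 * (n * + 4 - + 2 * (b k * + 4))                          ≡⟨ lemma t n (b k) ⟩
      t * + 0 + c k * + 8                                          ≡⟨ cong₂ (λ u v → t * u + c k * v) (C·D k) (e·D≡8 k) ⟨
      t * dot C (D k) + c k * dot (e k) (D k)                      ≡⟨ cong (_+_ (t * dot C (D k))) (sum-supported (λ i → c i * dot (e i) (D k)) k off-diagonal) ⟨
      t * dot C (D k) + sum (λ i → c i * dot (e i) (D k))          ≡⟨ R·B (suc k) ⟨
      dot R (D k)                                                  ∎
      where
      x·[e+f] : dot x (e k) + dot x (f k) ≡ n * + 4
      x·[e+f] = trans (sym (dot-⊕ʳ (e k) (f k) x)) (trans (cong (dot x) (centre k)) x·C)
      off-diagonal : ∀ i → i ≢ k → c i * dot (e i) (D k) ≡ + 0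
      off-diagonal i i≢k = trans (cong (c i *_) (e·D≡0 i k i≢k)) (ℤP.*-zeroʳ (c i))
      regroup : ∀ p q → + 2 * (p - q) ≡ + 2 * (p + q - + 2 * q)
      regroup = solve-∀
      lemma : ∀ t n b → + 2 * (n * + 4 - + 2 * (b * + 4)) ≡ t * + 0 + (n - + 2 * b) * + 8
      lemma = solve-∀

  data Spanned : V8 → Set where
    0ᵥ-spanned    : Spanned 0ᵥ
    C-spanned     : Spanned C
    e-spanned     : ∀ i → Spanned (e i)
    ⊕-spanned     : ∀ {x y} → Spanned x → Spanned y → Spanned (x ⊕ y)
    scale-spanned : ∀ k {x} → Spanned x → Spanned (scale k x)

  vsum-spanned : ∀ {n} (v : Fin n → V8) → (∀ i → Spanned (v i)) → Spanned (vsum v)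
  vsum-spanned {zero}  v _  = 0ᵥ-spanned
  vsum-spanned {suc n} v sp = ⊕-spanned (sp zero) (vsum-spanned (v ∘ suc) (sp ∘ suc))

  Λ-spanned : ∀ {x} → Spanned x → InΛ x
  Λ-spanned 0ᵥ-spanned            = Λ-0ᵥ
  Λ-spanned C-spanned             = Λ-C
  Λ-spanned (e-spanned i)         = Λ-e i
  Λ-spanned (⊕-spanned sx sy)     = Λ-⊕ (Λ-spanned sx) (Λ-spanned sy)
  Λ-spanned (scale-spanned k sx)  = Λ-scale k (Λ-spanned sx)

  data Residue : V8 → Set where
    0ᵥ-residue : Residue 0ᵥ
    C-residue  : Residue C
    e-residue  : Residue (vsum (vert e f ∘ e-clique))
    fe-residue : Residue (vsum (vert e f ∘ fe-clique))

  private
    span : ℤ → ℤ → (Fin 7 → ℤ) → V8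
    span u m b = scale u C ⊕ vsum (λ i → scale (m - b i) (e i))

    span-spanned : ∀ u m b → Spanned (span u m b)
    span-spanned u m b = ⊕-spanned (scale-spanned u C-spanned)
      (vsum-spanned (λ i → scale (m - b i) (e i)) (λ i → scale-spanned (m - b i) (e-spanned i)))

    residual : ∀ {x t n} u m b z → twice x ≡ scale t C ⊕ vsum (λ i → scale (n - + 2 * b i) (e i)) → ∀ j →
               lookup (twice (x ⊖ (span u m b ⊕ z))) j ≡
               (t - + 2 * u) * lookup C j + (n - + 2 * m) * lookup (vsum e) j - + 2 * lookup z j
    residual {x} {t} {n} u m b z 2x≡ j = begin
      lookup (twice (x ⊖ (span u m b ⊕ z))) j
        ≡⟨ lookup-scale (+ 2) (x ⊖ (span u m b ⊕ z)) j ⟩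
      + 2 * lookup (x ⊖ (span u m b ⊕ z)) j
        ≡⟨ cong (+ 2 *_) (lookup-⊖ x (span u m b ⊕ z) j) ⟩
      + 2 * (xⱼ - lookup (span u m b ⊕ z) j)
        ≡⟨ cong (λ k → + 2 * (xⱼ - k)) (trans (lookup-⊕ (span u m b) z j) (cong (_+ zⱼ) (trans
             (lookup-⊕ (scale u C) (vsum (λ i → scale (m - b i) (e i))) j)
             (cong₂ _+_ (lookup-scale u C j) (lookup-vsum-scale (λ i → m - b i) e j))))) ⟩
      + 2 * (xⱼ - (u * cⱼ + S₁ + zⱼ))
        ≡⟨ regroup xⱼ u cⱼ S₁ zⱼ ⟩
      + 2 * xⱼ - + 2 * u * cⱼ - + 2 * S₁ - + 2 * zⱼ
        ≡⟨ cong (λ k → k - + 2 * u * cⱼ - + 2 * S₁ - + 2 * zⱼ) 2xⱼ ⟩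
      t * cⱼ + S₂ - + 2 * u * cⱼ - + 2 * S₁ - + 2 * zⱼ
        ≡⟨ cong (λ k → t * cⱼ + k - + 2 * u * cⱼ - + 2 * S₁ - + 2 * zⱼ) S₂≡ ⟩
      t * cⱼ + ((n - + 2 * m) * sⱼ + + 2 * S₁) - + 2 * u * cⱼ - + 2 * S₁ - + 2 * zⱼ
        ≡⟨ collect t n u m cⱼ sⱼ S₁ zⱼ ⟩
      (t - + 2 * u) * cⱼ + (n - + 2 * m) * sⱼ - + 2 * zⱼ
        ∎
      where
      open ≡-Reasoning
      xⱼ = lookup x j
      zⱼ = lookup z j
      cⱼ = lookup C j
      sⱼ = lookup (vsum e) j
      ε : Fin 7 → ℤ
      ε i = lookup (e i) j
      S₁ = sum (λ i → (m - b i) * ε i)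
      S₂ = sum (λ i → (n - + 2 * b i) * ε i)
      2xⱼ : + 2 * xⱼ ≡ t * cⱼ + S₂
      2xⱼ = begin
        + 2 * xⱼ                                                      ≡⟨ lookup-scale (+ 2) x j ⟨
        lookup (twice x) j                                            ≡⟨ cong (λ v → lookup v j) 2x≡ ⟩
        lookup (scale t C ⊕ vsum (λ i → scale (n - + 2 * b i) (e i))) j
                                                                      ≡⟨ lookup-⊕ (scale t C) (vsum (λ i → scale (n - + 2 * b i) (e i))) j ⟩
        lookup (scale t C) j + lookup (vsum (λ i → scale (n - + 2 * b i) (e i))) j
                                                                      ≡⟨ cong₂ _+_ (lookup-scale t C j) (lookup-vsum-scale (λ i → n - + 2 * b i) e j) ⟩
        t * cⱼ + S₂                                                   ∎
      S₂≡ : S₂ ≡ (n - + 2 * m) * sⱼ + + 2 * S₁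
      S₂≡ = begin
        S₂
          ≡⟨ sum-cong-≗ (λ i → split n m (b i) (ε i)) ⟩
        sum (λ i → (n - + 2 * m) * ε i + + 2 * ((m - b i) * ε i))
          ≡⟨ ∑-distrib-+ (λ i → (n - + 2 * m) * ε i) (λ i → + 2 * ((m - b i) * ε i)) ⟩
        sum (λ i → (n - + 2 * m) * ε i) + sum (λ i → + 2 * ((m - b i) * ε i))
          ≡⟨ cong₂ _+_ (*-distribˡ-sum (n - + 2 * m) ε) (*-distribˡ-sum (+ 2) (λ i → (m - b i) * ε i)) ⟨
        (n - + 2 * m) * sum ε + + 2 * S₁
          ≡⟨ cong (λ k → (n - + 2 * m) * k + + 2 * S₁) (lookup-vsum e j) ⟨
        (n - + 2 * m) * sⱼ + + 2 * S₁
          ∎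
        where
        split : ∀ n m b ε → (n - + 2 * b) * ε ≡ (n - + 2 * m) * ε + + 2 * ((m - b) * ε)
        split = solve-∀
      regroup : ∀ x u c s z → + 2 * (x - (u * c + s + z)) ≡ + 2 * x - + 2 * u * c - + 2 * s - + 2 * z
      regroup = solve-∀
      collect : ∀ t n u m c s S z → t * c + ((n - + 2 * m) * s + + 2 * S) - + 2 * u * c - + 2 * S - + 2 * z ≡
                                    (t - + 2 * u) * c + (n - + 2 * m) * s - + 2 * z
      collect = solve-∀

    without-z : ∀ {x t n} u m b → twice x ≡ scale t C ⊕ vsum (λ i → scale (n - + 2 * b i) (e i)) → ∀ j →
                lookup (twice (x ⊖ (span u m b ⊕ 0ᵥ))) j ≡ (t - + 2 * u) * lookup C j + (n - + 2 * m) * lookup (vsum e) j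
    without-z {x} {t} {n} u m b 2x≡ j = trans (residual {x} {t} {n} u m b 0ᵥ 2x≡ j)
      (trans (cong (λ z → (t - + 2 * u) * lookup C j + (n - + 2 * m) * lookup (vsum e) j - + 2 * z) (lookup-0ᵥ j))
             (lemma ((t - + 2 * u) * lookup C j + (n - + 2 * m) * lookup (vsum e) j)))
      where
      lemma : ∀ a → a - + 2 * + 0 ≡ a
      lemma = solve-∀

    reduce : ∀ {x t n} → Parity t → Parity n → ∀ b → twice x ≡ scale t C ⊕ vsum (λ i → scale (n - + 2 * b i) (e i)) →
             Σ V8 λ K → Spanned K × Σ V8 λ w → Residue w × twice (x ⊖ K) ≡ w
    reduce {x} (even u) (even m) b 2x≡ = span u m b ⊕ 0ᵥ , ⊕-spanned (span-spanned u m b) 0ᵥ-spanned , 0ᵥ , 0ᵥ-residue ,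
      lookup-ext λ j → trans (without-z {x} {u * + 2} {m * + 2} u m b 2x≡ j) (trans (lemma u m (lookup C j) (lookup (vsum e) j)) (sym (lookup-0ᵥ j)))
      where
      lemma : ∀ u m c s → (u * + 2 - + 2 * u) * c + (m * + 2 - + 2 * m) * s ≡ + 0
      lemma = solve-∀
    reduce {x} (odd u) (even m) b 2x≡ = span u m b ⊕ 0ᵥ , ⊕-spanned (span-spanned u m b) 0ᵥ-spanned , C , C-residue ,
      lookup-ext λ j → trans (without-z {x} {u * + 2 + + 1} {m * + 2} u m b 2x≡ j) (lemma u m (lookup C j) (lookup (vsum e) j))
      where
      lemma : ∀ u m c s → (u * + 2 + + 1 - + 2 * u) * c + (m * + 2 - + 2 * m) * s ≡ c
      lemma = solve-∀
    reduce {x} (even u) (odd m) b 2x≡ = span u m b ⊕ 0ᵥ , ⊕-spanned (span-spanned u m b) 0ᵥ-spanned , vsum e , e-residue ,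
      lookup-ext λ j → trans (without-z {x} {u * + 2} {m * + 2 + + 1} u m b 2x≡ j) (lemma u m (lookup C j) (lookup (vsum e) j))
      where
      lemma : ∀ u m c s → (u * + 2 - + 2 * u) * c + (m * + 2 + + 1 - + 2 * m) * s ≡ s
      lemma = solve-∀
    -- C + Σ e = 2 e₀ + (f₀ + e₁ + … + e₆)
    reduce {x} (odd u) (odd m) b 2x≡ = span u m b ⊕ e zero , ⊕-spanned (span-spanned u m b) (e-spanned zero) ,
      vsum (vert e f ∘ fe-clique) , fe-residue ,
      lookup-ext λ j → trans (residual {x} {u * + 2 + + 1} {m * + 2 + + 1} u m b (e zero) 2x≡ j) (coordinate j)
      where
      coordinate : ∀ j → (u * + 2 + + 1 - + 2 * u) * lookup C j + (m * + 2 + + 1 - + 2 * m) * lookup (vsum e) j - + 2 * lookup (e zero) j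
                         ≡ lookup (vsum (vert e f ∘ fe-clique)) j
      coordinate j = begin
        (u * + 2 + + 1 - + 2 * u) * lookup C j + (m * + 2 + + 1 - + 2 * m) * lookup (vsum e) j - + 2 * e₀ⱼ
          ≡⟨ cong₂ (λ c s → (u * + 2 + + 1 - + 2 * u) * c + (m * + 2 + + 1 - + 2 * m) * s - + 2 * e₀ⱼ)
                   (lookup-⊕ (e zero) (f zero) j) (lookup-⊕ (e zero) (vsum (e ∘ suc)) j) ⟩
        (u * + 2 + + 1 - + 2 * u) * (e₀ⱼ + f₀ⱼ) + (m * + 2 + + 1 - + 2 * m) * (e₀ⱼ + rⱼ) - + 2 * e₀ⱼ
          ≡⟨ lemma u m e₀ⱼ f₀ⱼ rⱼ ⟩
        f₀ⱼ + rⱼ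
          ≡⟨ lookup-⊕ (f zero) (vsum (e ∘ suc)) j ⟨
        lookup (vsum (vert e f ∘ fe-clique)) j ∎
        where
        open ≡-Reasoning
        e₀ⱼ = lookup (e zero) j
        f₀ⱼ = lookup (f zero) j
        rⱼ  = lookup (vsum (e ∘ suc)) j
        lemma : ∀ u m a b r → (u * + 2 + + 1 - + 2 * u) * (a + b) + (m * + 2 + + 1 - + 2 * m) * (a + r) - + 2 * a ≡ b + r
        lemma = solve-∀

  decompose : ∀ {x} → InΛ x → Σ V8 λ K → Spanned K × Σ V8 λ w → Residue w × twice (x ⊖ K) ≡ w
  decompose {x} xΛ = reduce-expansion (twice-expansion {x} (dot-div4 {x} {C} xΛ Λ-C) (λ i → dot-div4 {x} {f i} xΛ (Λ-f i)))
    where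
    reduce-expansion : (Σ ℤ λ t → Σ ℤ λ n → Σ (Fin 7 → ℤ) λ b → twice x ≡ scale t C ⊕ vsum (λ i → scale (n - + 2 * b i) (e i))) →
                       Σ V8 λ K → Spanned K × Σ V8 λ w → Residue w × twice (x ⊖ K) ≡ w
    reduce-expansion (t , n , b , 2x≡) = reduce {x} (parity t) (parity n) b 2x≡

-- Extending the isometry between two crosspolytopes

module CrossCorrespondence {e f e′ f′ : Fin 7 → V8} (cp : IsCrossPolytope e f) (cp′ : IsCrossPolytope e′ f′) where
  private
    module S = CrossFrame cp
    module T = CrossFrame cp′
  open FrameCorrespondence S.frame T.frame public

  corresponds-vert : ∀ k → Corresponds (vert e f k) (vert e′ f′ k)
  corresponds-vert (inj₁ i) zero    = trans (S.e·C i) (sym (T.e·C i))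
  corresponds-vert (inj₂ i) zero    = trans (S.f·C i) (sym (T.f·C i))
  corresponds-vert (inj₁ i) (suc k) = e·D (i Fin.≟ k)
    where
    e·D : Dec (i ≡ k) → dot (e i) (S.D k) ≡ dot (e′ i) (T.D k)
    e·D (yes refl) = trans (S.e·D≡8 i) (sym (T.e·D≡8 i))
    e·D (no  i≢k)  = trans (S.e·D≡0 i k i≢k) (sym (T.e·D≡0 i k i≢k))
  corresponds-vert (inj₂ i) (suc k) = f·D (i Fin.≟ k)
    where
    f·D : Dec (i ≡ k) → dot (f i) (S.D k) ≡ dot (f′ i) (T.D k)
    f·D (yes refl) = trans (S.f·D≡-8 i) (sym (T.f·D≡-8 i))
    f·D (no  i≢k)  = trans (S.f·D≡0 i k i≢k) (sym (T.f·D≡0 i k i≢k))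

  corresponds-0ᵥ : Corresponds 0ᵥ 0ᵥ
  corresponds-0ᵥ k = trans (dot-0ᵥˡ (S.B k)) (sym (dot-0ᵥˡ (T.B k)))

  corresponds-clique : ∀ {n} (s : Fin n → Idx) → Corresponds (vsum (vert e f ∘ s)) (vsum (vert e′ f′ ∘ s))
  corresponds-clique {zero}  s = corresponds-0ᵥ
  corresponds-clique {suc n} s = corresponds-⊕ {vert e f (s zero)} {vsum (vert e f ∘ s ∘ suc)}
    {vert e′ f′ (s zero)} {vsum (vert e′ f′ ∘ s ∘ suc)} (corresponds-vert (s zero)) (corresponds-clique (s ∘ suc))

  Transportable : V8 → Set
  Transportable x = Σ V8 λ z → InΛ z × Corresponds x z

  transportable-⊕ : ∀ {x y} → Transportable x → Transportable y → Transportable (x ⊕ y)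
  transportable-⊕ {x} {y} (x′ , x′Λ , x~x′) (y′ , y′Λ , y~y′) =
    x′ ⊕ y′ , Λ-⊕ x′Λ y′Λ , corresponds-⊕ {x} {y} {x′} {y′} x~x′ y~y′

  transportable-spanned : ∀ {x} → S.Spanned x → Transportable x
  transportable-spanned S.0ᵥ-spanned           = 0ᵥ , Λ-0ᵥ , corresponds-0ᵥ
  transportable-spanned S.C-spanned            = transportable-⊕ {e zero} {f zero} (e′ zero , T.Λ-e zero , corresponds-vert (inj₁ zero))
                                                                                   (f′ zero , T.Λ-f zero , corresponds-vert (inj₂ zero))
  transportable-spanned (S.e-spanned i)        = e′ i , T.Λ-e i , corresponds-vert (inj₁ i)
  transportable-spanned (S.⊕-spanned {x} {y} sx sy) = transportable-⊕ {x} {y} (transportable-spanned sx) (transportable-spanned sy)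
  transportable-spanned (S.scale-spanned k {x} sx) = scaled {x} (transportable-spanned sx)
    where
    scaled : ∀ {x} → Transportable x → Transportable (scale k x)
    scaled {x} (x′ , x′Λ , x~x′) = scale k x′ , Λ-scale k x′Λ , corresponds-scale k {x} {x′} x~x′

  transportable-half : ∀ {y s s′} → InΛ y → twice y ≡ s → Corresponds s s′ → (In2Λ s → In2Λ s′) → Transportable y
  transportable-half {y} {s} {s′} yΛ 2y≡s s~s′ s-to-s′ = halve (s-to-s′ (y , yΛ , sym 2y≡s))
    where
    halve : In2Λ s′ → Transportable y
    halve (y′ , y′Λ , s′≡2y′) = y′ , y′Λ , corresponds-half {y} {y′} (subst₂ Corresponds (sym 2y≡s) s′≡2y′ s~s′)

  module _ (e-condition  : In2Λ (vsum (vert e f ∘ e-clique))  → In2Λ (vsum (vert e′ f′ ∘ e-clique)))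
           (fe-condition : In2Λ (vsum (vert e f ∘ fe-clique)) → In2Λ (vsum (vert e′ f′ ∘ fe-clique))) where

    transportable-residue : ∀ {y w} → InΛ y → S.Residue w → twice y ≡ w → Transportable y
    transportable-residue {y} yΛ S.0ᵥ-residue 2y≡w =
      transportable-half {y} {0ᵥ} {0ᵥ} yΛ 2y≡w corresponds-0ᵥ (λ _ → 0ᵥ , Λ-0ᵥ , refl)
    transportable-residue {y} yΛ S.C-residue 2y≡w =
      ⊥-elim (norm16⇒∉2Λ (IsOrthogonalFrame.norm S.frame zero) (y , yΛ , sym 2y≡w))
    transportable-residue {y} yΛ S.e-residue 2y≡w =
      transportable-half {y} {vsum (vert e f ∘ e-clique)} {vsum (vert e′ f′ ∘ e-clique)}
        yΛ 2y≡w (corresponds-clique e-clique) e-condition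
    transportable-residue {y} yΛ S.fe-residue 2y≡w =
      transportable-half {y} {vsum (vert e f ∘ fe-clique)} {vsum (vert e′ f′ ∘ fe-clique)}
        yΛ 2y≡w (corresponds-clique fe-clique) fe-condition

    transportable : ∀ {x} → InΛ x → Transportable x
    transportable {x} xΛ = from-decomposition (S.decompose xΛ)
      where
      from-decomposition : (Σ V8 λ K → S.Spanned K × Σ V8 λ w → S.Residue w × twice (x ⊖ K) ≡ w) → Transportable x
      from-decomposition (K , K-spanned , w , residue , 2[x-K]≡w) =
        subst Transportable (⊖-⊕-cancel x K) (transportable-⊕ {x ⊖ K} {K}
          (transportable-residue {x ⊖ K} {w} (Λ-⊖ xΛ (S.Λ-spanned K-spanned)) residue 2[x-K]≡w)
          (transportable-spanned K-spanned))

crossPolytope-extension : ∀ {e f e′ f′} → IsCrossPolytope e f → IsCrossPolytope e′ f′ →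
  (In2Λ (vsum (vert e f ∘ e-clique))  ⇔ In2Λ (vsum (vert e′ f′ ∘ e-clique))) →
  (In2Λ (vsum (vert e f ∘ fe-clique)) ⇔ In2Λ (vsum (vert e′ f′ ∘ fe-clique))) →
  Σ AutΛ λ w → ∀ k → AutΛ.map w (vert e f k) ≡ vert e′ f′ k
crossPolytope-extension {e} {f} {e′} {f′} cp cp′ e⇔e′ fe⇔fe′ =
  automorphism forth back , λ k → transfer-corresponds {vert e f k} {vert e′ f′ k} (corresponds-vert k)
  where
  open CrossCorrespondence cp cp′
  forth : ∀ x → InΛ x → Transportable x
  forth x = transportable (Equivalence.to e⇔e′) (Equivalence.to fe⇔fe′)
  back : ∀ z → InΛ z → Σ V8 λ x → InΛ x × Corresponds x z
  back z zΛ = flip (CrossCorrespondence.transportable cp′ cp (Equivalence.from e⇔e′) (Equivalence.from fe⇔fe′) zΛ)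
    where
    flip : CrossCorrespondence.Transportable cp′ cp z → Σ V8 λ x → InΛ x × Corresponds x z
    flip (x , xΛ , z~x) = x , xΛ , λ k → sym (z~x k)

isCrossPolytope-transfer : ∀ {e f} (g : Idx → V8) → IsCrossPolytope e f → (∀ k → IsRoot (g k)) →
  (∀ k l → dot (g k) (g l) ≡ dot (vert e f k) (vert e f l)) → IsCrossPolytope (g ∘ inj₁) (g ∘ inj₂)
isCrossPolytope-transfer g cp g-roots gram = record
  { roots = λ { (inj₁ i) → g-roots (inj₁ i) ; (inj₂ i) → g-roots (inj₂ i) }
  ; ef0   = λ i → trans (gram (inj₁ i) (inj₂ i)) (ef0 i)
  ; ee1   = λ i j i≢j → trans (gram (inj₁ i) (inj₁ j)) (ee1 i j i≢j)
  ; ef1   = λ i j i≢j → trans (gram (inj₁ i) (inj₂ j)) (ef1 i j i≢j)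
  ; ff1   = λ i j i≢j → trans (gram (inj₂ i) (inj₂ j)) (ff1 i j i≢j)
  }
  where open IsCrossPolytope cp

e-clique-edges : ∀ {e f} → IsCrossPolytope e f → ∀ i j → i ≢ j → dot (vert e f (e-clique i)) (vert e f (e-clique j)) ≡ + 4
e-clique-edges cp = IsCrossPolytope.ee1 cp

fe-clique-edges : ∀ {e f} → IsCrossPolytope e f → ∀ i j → i ≢ j → dot (vert e f (fe-clique i)) (vert e f (fe-clique j)) ≡ + 4
fe-clique-edges     cp zero    zero    0≢0 = ⊥-elim (0≢0 refl)
fe-clique-edges {e} {f} cp zero (suc j) _ = trans (dot-comm (f zero) (e (suc j))) (IsCrossPolytope.ef1 cp (suc j) zero λ ())
fe-clique-edges     cp (suc i) zero    _   = IsCrossPolytope.ef1 cp (suc i) zero λ ()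
fe-clique-edges     cp (suc i) (suc j) i≢j = IsCrossPolytope.ee1 cp (suc i) (suc j) i≢j

vert-∘inj : ∀ (g : Idx → V8) k → vert (g ∘ inj₁) (g ∘ inj₂) k ≡ g k
vert-∘inj g (inj₁ i) = refl
vert-∘inj g (inj₂ i) = refl

corollary3p31 : (e₁ f₁ e₂ f₂ : Fin 7 → V8) →
    IsCrossPolytope e₁ f₁ → IsCrossPolytope e₂ f₂ →
    (φ : Idx ↔ Idx) →
    (∀ k l → dot (vert e₂ f₂ (Inverse.to φ k)) (vert e₂ f₂ (Inverse.to φ l))
               ≡ dot (vert e₁ f₁ k) (vert e₁ f₁ l)) →
    (Σ AutΛ λ w → ∀ k → AutΛ.map w (vert e₁ f₁ k) ≡ vert e₂ f₂ (Inverse.to φ k))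
    ⇔
    (∀ (s : Fin 7 → Idx) →
      (∀ i j → i ≢ j → dot (vert e₁ f₁ (s i)) (vert e₁ f₁ (s j)) ≡ + 4) →
      In2Λ (vsum (vert e₁ f₁ ∘ s)) ⇔ In2Λ (vsum (vert e₂ f₂ ∘ Inverse.to φ ∘ s)))
corollary3p31 e₁ f₁ e₂ f₂ cp₁ cp₂ φ gram = mk⇔ clique-parities automorphism
  where
  g : Idx → V8
  g = vert e₂ f₂ ∘ Inverse.to φ
  cp′ : IsCrossPolytope (g ∘ inj₁) (g ∘ inj₂)
  cp′ = isCrossPolytope-transfer g cp₁ (IsCrossPolytope.roots cp₂ ∘ Inverse.to φ) gram
  Clique : (Fin 7 → Idx) → Set
  Clique s = ∀ i j → i ≢ j → dot (vert e₁ f₁ (s i)) (vert e₁ f₁ (s j)) ≡ + 4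

  clique-parities : (Σ AutΛ λ w → ∀ k → AutΛ.map w (vert e₁ f₁ k) ≡ g k) →
                    ∀ s → Clique s → In2Λ (vsum (vert e₁ f₁ ∘ s)) ⇔ In2Λ (vsum (g ∘ s))
  clique-parities (w , w≡g) s _ = subst (λ u → In2Λ (vsum (vert e₁ f₁ ∘ s)) ⇔ In2Λ u)
    (vsum-cong {7} {AutΛ.map w ∘ vert e₁ f₁ ∘ s} {g ∘ s} (w≡g ∘ s))
    (AutΛ-vsum-2Λ w (vert e₁ f₁ ∘ s) (λ i → proj₁ (IsCrossPolytope.roots cp₁ (s i))))

  automorphism : (∀ s → Clique s → In2Λ (vsum (vert e₁ f₁ ∘ s)) ⇔ In2Λ (vsum (g ∘ s))) →
                 Σ AutΛ λ w → ∀ k → AutΛ.map w (vert e₁ f₁ k) ≡ g k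
  automorphism parities = relabel (crossPolytope-extension {e₁} {f₁} {g ∘ inj₁} {g ∘ inj₂} cp₁ cp′
    (parities e-clique (e-clique-edges cp₁)) (parities fe-clique (fe-clique-edges cp₁)))
    where
    relabel : (Σ AutΛ λ w → ∀ k → AutΛ.map w (vert e₁ f₁ k) ≡ vert (g ∘ inj₁) (g ∘ inj₂) k) →
              Σ AutΛ λ w → ∀ k → AutΛ.map w (vert e₁ f₁ k) ≡ g k
    relabel (w , w≡g) = w , λ k → trans (w≡g k) (vert-∘inj g k)
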